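{- Let $G$ be a finite, simple, connected graph with diameter $D(G)$, let $k \geq 3$ be an integer, and let $I_s, I_t$ be independent sets of $G$. Then $I_s \rightsquigarrow_k I_t$ if and only if $I_s \rightsquigarrow_{D(G)} I_t$.
   Context: For an integer $k \ge 1$ and independent sets $I, J$ of a graph $G$, write $I \leftrightarrow_k J$ if $|I \setminus J| = |J \setminus I| = 1$ and $\mathrm{dist}_G(u,v) \le k$, where $I \setminus J = \{u\}$ and $J \setminus I = \{v\}$; one such step is a move of the token on $u$ to $v$ (the $k$-Jump model). Write $I \rightsquigarrow_k J$ if there is a finite sequence $I = I_0, I_1, \dots, I_\ell = J$ ($\ell \ge 0$) of independent sets of $G$ with $I_j \leftrightarrow_k I_{j+1}$ for all $0 \le j < \ell$. The case $k = D(G)$ is the Token Jumping model. -}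

module Defs where

open import Data.Nat using (ℕ; zero; suc; _≤_)
open import Data.Fin using (Fin)
open import Data.Fin.Subset using (Subset; _∈_; _─_; ⁅_⁆)
open import Data.Product using (Σ; ∃; _×_; _,_)
open import Relation.Nullary using (¬_; Dec)
open import Relation.Binary.PropositionalEquality using (_≡_)

record Graph (n : ℕ) : Set₁ where
  field
    Adj     : Fin n → Fin n → Set
    adj-sym : ∀ {u v} → Adj u v → Adj v u
    irrefl  : ∀ {u} → ¬ Adj u u
    adj?    : ∀ u v → Dec (Adj u v)
open Graph public

data Walk {n : ℕ} (G : Graph n) : Fin n → Fin n → ℕ → Set where
  [] : ∀ {u} → Walk G u u 0
  _∷_ : ∀ {u w v m} → Adj G u w → Walk G w v m → Walk G u v (suc m)

DistLe : ∀ {n} → Graph n → Fin n → Fin n → ℕ → Set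
DistLe G u v k = ∃ λ m → m ≤ k × Walk G u v m

Connected : ∀ {n} → Graph n → Set
Connected G = ∀ u v → ∃ λ m → Walk G u v m

IsDiameter : ∀ {n} → Graph n → ℕ → Set
IsDiameter G d = (∀ u v → DistLe G u v d)
               × (∀ d′ → (∀ u v → DistLe G u v d′) → d ≤ d′)

Independent : ∀ {n} → Graph n → Subset n → Set
Independent G I = ∀ u v → u ∈ I → v ∈ I → ¬ Adj G u v

Step : ∀ {n} → Graph n → ℕ → Subset n → Subset n → Set
Step G k I J = ∃ λ u → ∃ λ v →
  (I ─ J ≡ ⁅ u ⁆) × (J ─ I ≡ ⁅ v ⁆) × DistLe G u v k

data Reach {n : ℕ} (G : Graph n) (k : ℕ) : Subset n → Subset n → Set where
  done : ∀ {I} → Reach G k I I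
  step : ∀ {I J L} → Independent G J → Step G k I J → Reach G k J L → Reach G k I L

{-# OPTIONS --safe #-}
module Submission where

-- A k-jump is a D-jump, since every distance is at most D. Conversely, a D-jump of the token on u
-- to v is simulated by k-jumps along a walk from u to v, by induction on the walk, keeping the
-- moving token within distance 2 of the next walk vertex p. If p = v, the token jumps there. If
-- another token s lies on or next to p, then s is sent on to v by induction and the moving token
-- jumps into the place s left, at distance at most 3. Otherwise no other token lies on or next
-- to p, so the token can jump to p without breaking independence, and it continues from there.

open import Defs
open import Data.Nat using (ℕ; _+_; _≤_; s≤s; z≤n)
open import Data.Nat.Properties using (≤-refl; ≤-trans; +-mono-≤)
open import Data.Fin using (Fin; _≟_)
open import Data.Fin.Properties using (any?)
open import Data.Fin.Subset using (Subset; _∈_; _∉_; _─_; _-_; _∪_; ⁅_⁆)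
open import Data.Fin.Subset.Properties
  using (_∈?_; ⊆-antisym; x∈⁅x⁆; x∈⁅y⁆⇒x≡y; p─q⊆p; x∈p∧x∉q⇒x∈p─q; x∈p∧x≢y⇒x∈p-y; x∈p∪q⁺; x∈p∪q⁻)
open import Data.Vec using (_∷_; there)
open import Data.Product using (∃; _×_; _,_; proj₁; proj₂)
open import Data.Sum using (inj₁; inj₂)
open import Relation.Binary.Construct.Closure.Reflexive using (ReflClosure; refl; [_])
import Relation.Binary.Construct.Closure.Reflexive.Properties as ReflClosure
open import Relation.Nullary using (¬_; Dec; yes; no; contradiction)
open import Relation.Nullary.Decidable using (_×-dec_; ¬?)
open import Relation.Binary.PropositionalEquality using (_≡_; _≢_; refl; ≢-sym; subst; sym)

x∈p─q⇒x∉q : ∀ {n} {p q : Subset n} {x} → x ∈ p ─ q → x ∉ q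
x∈p─q⇒x∉q {p = _ ∷ p} {_ ∷ q} (there x∈p─q) (there x∈q) = x∈p─q⇒x∉q {p = p} x∈p─q x∈q

∈∧∉⇒≢ : ∀ {n} {p : Subset n} {x y} → x ∈ p → y ∉ p → x ≢ y
∈∧∉⇒≢ x∈p y∉p refl = y∉p x∈p

record OnlyDifference {n} (I J : Subset n) (u : Fin n) : Set where
  field
    member  : u ∈ I
    missing : u ∉ J
    kept    : ∀ {w} → w ∈ I → w ≢ u → w ∈ J
open OnlyDifference

module _ {n} {I J : Subset n} {u : Fin n} where

  ─≡⁅⁆⇒OnlyDifference : I ─ J ≡ ⁅ u ⁆ → OnlyDifference I J u
  ─≡⁅⁆⇒OnlyDifference I─J≡u = record
    { member  = p─q⊆p I J u∈I─J
    ; missing = x∈p─q⇒x∉q {p = I} u∈I─J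
    ; kept    = I⊆J
    }
    where
    u∈I─J : u ∈ I ─ J
    u∈I─J = subst (u ∈_) (sym I─J≡u) (x∈⁅x⁆ u)

    I⊆J : ∀ {w} → w ∈ I → w ≢ u → w ∈ J
    I⊆J {w} w∈I w≢u with w ∈? J
    ... | yes w∈J = w∈J
    ... | no  w∉J = contradiction (x∈⁅y⁆⇒x≡y u (subst (w ∈_) I─J≡u (x∈p∧x∉q⇒x∈p─q w∈I w∉J))) w≢u

  OnlyDifference⇒─≡⁅⁆ : OnlyDifference I J u → I ─ J ≡ ⁅ u ⁆
  OnlyDifference⇒─≡⁅⁆ d = ⊆-antisym I─J⊆u u⊆I─J
    where
    I─J⊆u : ∀ {w} → w ∈ I ─ J → w ∈ ⁅ u ⁆
    I─J⊆u {w} w∈I─J with w ≟ u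
    ... | yes refl = x∈⁅x⁆ u
    ... | no  w≢u  = contradiction (kept d (p─q⊆p I J w∈I─J) w≢u) (x∈p─q⇒x∉q {p = I} w∈I─J)

    u⊆I─J : ∀ {w} → w ∈ ⁅ u ⁆ → w ∈ I ─ J
    u⊆I─J w∈u with x∈⁅y⁆⇒x≡y u w∈u
    ... | refl = x∈p∧x∉q⇒x∈p─q (member d) (missing d)

Jump : ∀ {n} → Subset n → Subset n → Fin n → Fin n → Set
Jump I J u v = OnlyDifference I J u × OnlyDifference J I v

module _ {n} {I : Subset n} where

  Jump-move : ∀ {u v} → u ∈ I → v ∉ I → Jump I ((I - u) ∪ ⁅ v ⁆) u v
  Jump-move {u} {v} u∈I v∉I =
    record { member  = u∈I
           ; missing = u∉K
           ; kept    = λ w∈I w≢u → x∈p∪q⁺ (inj₁ (x∈p∧x≢y⇒x∈p-y w∈I w≢u)) } ,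
    record { member  = x∈p∪q⁺ (inj₂ (x∈⁅x⁆ v))
           ; missing = v∉I
           ; kept    = K⊆I }
    where
    u∉K : u ∉ (I - u) ∪ ⁅ v ⁆
    u∉K u∈K with x∈p∪q⁻ (I - u) ⁅ v ⁆ u∈K
    ... | inj₁ u∈I-u = x∈p─q⇒x∉q {p = I} u∈I-u (x∈⁅x⁆ u)
    ... | inj₂ u∈v   = ∈∧∉⇒≢ u∈I v∉I (x∈⁅y⁆⇒x≡y v u∈v)

    K⊆I : ∀ {w} → w ∈ (I - u) ∪ ⁅ v ⁆ → w ≢ v → w ∈ I
    K⊆I {w} w∈K w≢v with x∈p∪q⁻ (I - u) ⁅ v ⁆ w∈K
    ... | inj₁ w∈I-u = p─q⊆p I ⁅ u ⁆ w∈I-u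
    ... | inj₂ w∈v   = contradiction (x∈⁅y⁆⇒x≡y v w∈v) w≢v

  Jump-via : ∀ {J K u v p} → Jump I J u v → Jump I K u p → p ≢ v → Jump K J p v
  Jump-via (IJ , JI) (IK , KI) p≢v =
    record { member  = member KI
           ; missing = λ p∈J → missing KI (kept JI p∈J p≢v)
           ; kept    = λ w∈K w≢p → kept IJ (kept KI w∈K w≢p) (∈∧∉⇒≢ w∈K (missing IK)) } ,
    record { member  = member JI
           ; missing = λ v∈K → missing JI (kept KI v∈K (≢-sym p≢v))
           ; kept    = λ w∈J w≢v → kept IK (kept JI w∈J w≢v) (∈∧∉⇒≢ w∈J (missing IJ)) }

  Jump-relay : ∀ {J K u v s} → Jump I J u v → Jump I K s v → s ≢ u → Jump K J u s
  Jump-relay {J} {K} {u} {v} {s} (IJ , JI) (IK , KI) s≢u =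
    record { member  = kept IK (member IJ) (≢-sym s≢u)
           ; missing = missing IJ
           ; kept    = K⊆J } ,
    record { member  = kept IJ (member IK) s≢u
           ; missing = missing IK
           ; kept    = J⊆K }
    where
    K⊆J : ∀ {w} → w ∈ K → w ≢ u → w ∈ J
    K⊆J {w} w∈K w≢u with w ≟ v
    ... | yes refl = member JI
    ... | no  w≢v  = kept IJ (kept KI w∈K w≢v) w≢u

    J⊆K : ∀ {w} → w ∈ J → w ≢ s → w ∈ K
    J⊆K {w} w∈J w≢s with w ≟ v
    ... | yes refl = member KI
    ... | no  w≢v  = kept IK (kept JI w∈J w≢v) w≢s

module _ {n} (G : Graph n) where

  _++ʷ_ : ∀ {u w v a b} → Walk G u w a → Walk G w v b → Walk G u v (a + b)
  []         ++ʷ q = q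
  (e ∷ rest) ++ʷ q = e ∷ (rest ++ʷ q)

  DistLe-trans : ∀ {u w v a b} → DistLe G u w a → DistLe G w v b → DistLe G u v (a + b)
  DistLe-trans (l , l≤a , p) (m , m≤b , q) = l + m , +-mono-≤ l≤a m≤b , p ++ʷ q

  DistLe-weaken : ∀ {u v a b} → a ≤ b → DistLe G u v a → DistLe G u v b
  DistLe-weaken a≤b (m , m≤a , p) = m , ≤-trans m≤a a≤b , p

  ReflClosure⇒DistLe : ∀ {u v} → ReflClosure (Adj G) u v → DistLe G u v 1
  ReflClosure⇒DistLe refl  = 0 , z≤n , []
  ReflClosure⇒DistLe [ e ] = 1 , ≤-refl , e ∷ []

  Blocked : Subset n → Fin n → Fin n → Set
  Blocked I u p = ∃ λ s → s ∈ I × s ≢ u × ReflClosure (Adj G) s p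

  blocked? : ∀ I u p → Dec (Blocked I u p)
  blocked? I u p = any? λ s → (s ∈? I) ×-dec ¬? (s ≟ u) ×-dec ReflClosure.dec _≟_ (adj? G) s p

  Jump-independent : ∀ {I K u v} → Jump I K u v → Independent G I
                   → (∀ {w} → w ∈ I → w ≢ u → ¬ Adj G v w) → Independent G K
  Jump-independent {v = v} (IK , KI) indI v≁I a b a∈K b∈K a~b with a ≟ v | b ≟ v
  ... | yes refl | yes refl = irrefl G a~b
  ... | yes refl | no b≢v   = v≁I (kept KI b∈K b≢v) (∈∧∉⇒≢ b∈K (missing IK)) a~b
  ... | no a≢v   | yes refl = v≁I (kept KI a∈K a≢v) (∈∧∉⇒≢ a∈K (missing IK)) (adj-sym G a~b)
  ... | no a≢v   | no b≢v   = indI a b (kept KI a∈K a≢v) (kept KI b∈K b≢v) a~b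

  _◅◅_ : ∀ {k I J L} → Reach G k I J → Reach G k J L → Reach G k I L
  done          ◅◅ r′ = r′
  step indJ s r ◅◅ r′ = step indJ s (r ◅◅ r′)

  Reach-concatMap : ∀ {k k′ I J}
                  → (∀ {I J} → Independent G I → Independent G J → Step G k I J → Reach G k′ I J)
                  → Independent G I → Reach G k I J → Reach G k′ I J
  Reach-concatMap f indI done            = done
  Reach-concatMap f indI (step indJ s r) = f indI indJ s ◅◅ Reach-concatMap f indJ r

  module _ {k : ℕ} where

    Reach-single : ∀ {I J u v} → Independent G J → Jump I J u v → DistLe G u v k → Reach G k I J
    Reach-single indJ (IJ , JI) d =
      step indJ (_ , _ , OnlyDifference⇒─≡⁅⁆ IJ , OnlyDifference⇒─≡⁅⁆ JI , d) done

    Reach-relay : ∀ {I J u v s} → 1 ≤ k → Independent G I → Independent G J → Jump I J u v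
                → s ∈ I → s ≢ u → DistLe G u s k
                → (∀ {K} → Independent G K → Jump I K s v → Reach G k I K) → Reach G k I J
    Reach-relay {I} {u = u} {v} {s} 1≤k indI indJ (IJ , JI) s∈I s≢u u-s reach-K with adj? G u v
    ... | yes u~v = Reach-single indJ (IJ , JI) (DistLe-weaken 1≤k (ReflClosure⇒DistLe [ u~v ]))
    ... | no  u≁v = reach-K indK IK ◅◅ Reach-single indJ (Jump-relay (IJ , JI) IK s≢u) u-s
      where
      IK : Jump I ((I - s) ∪ ⁅ v ⁆) s v
      IK = Jump-move s∈I (missing JI)

      -- This is where u ≁ v is needed: the token on u is still present when v is occupied.
      v≁I : ∀ {w} → w ∈ I → w ≢ s → ¬ Adj G v w
      v≁I {w} w∈I w≢s v~w with w ≟ u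
      ... | yes refl = u≁v (adj-sym G v~w)
      ... | no  w≢u  = indJ v w (member JI) (kept IJ w∈I w≢u) v~w

      indK : Independent G ((I - s) ∪ ⁅ v ⁆)
      indK = Jump-independent IK indI v≁I

    Reach-advance : ∀ {I J u v p} → Independent G I → Jump I J u v
                  → p ∉ I → p ≢ v → (∀ {w} → w ∈ I → w ≢ u → ¬ Adj G p w) → DistLe G u p k
                  → (∀ {K} → Independent G K → Jump K J p v → Reach G k K J) → Reach G k I J
    Reach-advance {I} {u = u} {p = p} indI j p∉I p≢v p≁I u-p reach-J =
      Reach-single indK IK u-p ◅◅ reach-J indK (Jump-via j IK p≢v)
      where
      IK : Jump I ((I - u) ∪ ⁅ p ⁆) u p
      IK = Jump-move (member (proj₁ j)) p∉I

      indK : Independent G ((I - u) ∪ ⁅ p ⁆)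
      indK = Jump-independent IK indI p≁I

module _ {n} (G : Graph n) {k : ℕ} (3≤k : 3 ≤ k) where

  private
    1≤k : 1 ≤ k
    1≤k = ≤-trans (s≤s z≤n) 3≤k

    2≤k : 2 ≤ k
    2≤k = ≤-trans (s≤s (s≤s z≤n)) 3≤k

  mutual
    Jump⇒Reach-along : ∀ {x v m I J u} → Walk G x v m → Independent G I → Independent G J
                     → Jump I J u v → ReflClosure (Adj G) u x → Reach G k I J
    Jump⇒Reach-along []           indI indJ j u≈v =
      Reach-single G indJ j (DistLe-weaken G 1≤k (ReflClosure⇒DistLe G u≈v))
    Jump⇒Reach-along (x~p ∷ rest) indI indJ j u≈x =
      Jump⇒Reach-from rest indI indJ j
        (DistLe-trans G (ReflClosure⇒DistLe G u≈x) (ReflClosure⇒DistLe G [ x~p ]))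

    Jump⇒Reach-from : ∀ {p v m I J u} → Walk G p v m → Independent G I → Independent G J
                    → Jump I J u v → DistLe G u p 2 → Reach G k I J
    Jump⇒Reach-from {p} {v} {I = I} {u = u} rest indI indJ j u-p with p ≟ v | blocked? G I u p
    ... | yes refl | _ = Reach-single G indJ j (DistLe-weaken G 2≤k u-p)
    ... | no p≢v | yes (s , s∈I , s≢u , s≈p) =
      Reach-relay G 1≤k indI indJ j s∈I s≢u (DistLe-weaken G 3≤k u-s)
        λ indK jK → Jump⇒Reach-along rest indI indK jK s≈p
      where
      u-s : DistLe G u s 3
      u-s = DistLe-trans G u-p (ReflClosure⇒DistLe G (ReflClosure.sym (adj-sym G) s≈p))
    ... | no p≢v | no unblocked with p ≟ u
    ...   | yes refl = Jump⇒Reach-along rest indI indJ j refl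
    ...   | no  p≢u  =
      Reach-advance G indI j (λ p∈I → unblocked (p , p∈I , p≢u , refl)) p≢v
        (λ w∈I w≢u p~w → unblocked (_ , w∈I , w≢u , [ adj-sym G p~w ])) (DistLe-weaken G 2≤k u-p)
        λ indK jK → Jump⇒Reach-along rest indK indJ jK refl

  Jump⇒Reach : ∀ {I J u v} → Connected G → Independent G I → Independent G J → Jump I J u v
             → Reach G k I J
  Jump⇒Reach {u = u} {v} connected indI indJ j =
    Jump⇒Reach-along (proj₂ (connected u v)) indI indJ j refl

theorem1 : ∀ {n} (G : Graph n) → Connected G → (D : ℕ) → IsDiameter G D
    → (k : ℕ) → 3 ≤ k → (Is It : Subset n) → Independent G Is → Independent G It
    → (Reach G k Is It → Reach G D Is It) × (Reach G D Is It → Reach G k Is It)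
theorem1 G connected D diameter k 3≤k _ _ indS _ =
  Reach-concatMap G coarsen indS , Reach-concatMap G refine indS
  where
  coarsen : ∀ {I J} → Independent G I → Independent G J → Step G k I J → Reach G D I J
  coarsen _ indJ (u , v , I─J , J─I , _) = step indJ (u , v , I─J , J─I , proj₁ diameter u v) done

  refine : ∀ {I J} → Independent G I → Independent G J → Step G D I J → Reach G k I J
  refine indI indJ (_ , _ , I─J , J─I , _) =
    Jump⇒Reach G 3≤k connected indI indJ (─≡⁅⁆⇒OnlyDifference I─J , ─≡⁅⁆⇒OnlyDifference J─I)
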